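{- For any composition $\alpha$ of $n$, the set $C_{\alpha,\alpha}$ contains exactly one pair $(T,S)$, and for this pair $\operatorname{perm}(T)$ is the identity permutation.
   Context: A composition of $n$ is a finite sequence of positive integers summing to $n$. For a composition $\gamma=(\gamma_1,\dots,\gamma_\ell)$, its diagram has cells $(i,j)$, $1\le i\le\ell$, $1\le j\le\gamma_i$. An immaculate tableau of shape $\gamma$ is a filling by positive integers with rows weakly increasing left to right and first column strictly increasing top to bottom; its content is the weak composition counting entries of each value. For an integer sequence $a$, $\operatorname{fl}(a)$ deletes its zero entries. Tunnel hook coverings (THCs), introduced by Allen and Mason; only these facts are needed: for a composition $\gamma=(\gamma_1,\dots,\gamma_\ell)$, each THC $T$ of shape $\gamma$ has a permutation $\operatorname{perm}(T)\in S_\ell$, and $T\mapsto\operatorname{perm}(T)$ is a bijection from THCs of shape $\gamma$ onto $S_\ell$; $\Delta_i(T)=\gamma_i+\sigma_i-i$ for $\sigma=\operatorname{perm}(T)$; the content of $T$ is $\operatorname{fl}(\Delta(T))$. For compositions $\alpha,\beta$ of $n$, $C_{\alpha,\beta}$ is the set of pairs $(T,S)$ where $T$ is a THC with content $\alpha$, $S$ is an immaculate tableau with content $\beta$, and $T$ and $S$ have the same shape. -}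

module Defs where

open import Data.Nat using (ℕ; zero; suc; _+_; _≤_; _<_; _<?_; _≡ᵇ_)
open import Data.Bool using (if_then_else_)
open import Data.Fin using (Fin; toℕ; fromℕ<)
open import Data.Fin.Permutation using (Permutation′; _⟨$⟩ʳ_)
open import Data.List using (List; []; _∷_; length; lookup; map; filter; tabulate)
open import Data.Nat.ListAction using (sum)
open import Data.List.Relation.Unary.All using (All)
open import Data.Integer using (ℤ; +_; _-_; _≟_) renaming (_+_ to _+ℤ_)
open import Data.Product using (Σ; _×_)
open import Relation.Nullary using (¬?; yes; no)
open import Relation.Binary.PropositionalEquality using (_≡_)

IsComposition : ℕ → List ℕ → Set
IsComposition n α = All (0 <_) α × sum α ≡ n

sumFin : (m : ℕ) → (Fin m → ℕ) → ℕ
sumFin zero    f = 0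
sumFin (suc m) f = f Fin.zero + sumFin m (λ i → f (Fin.suc i))

-- a filling of the diagram of γ: row i (0-based) has cells j < γ_i
Filling : List ℕ → Set
Filling γ = (i : Fin (length γ)) → Fin (lookup γ i) → ℕ

IsImmaculate : (γ : List ℕ) → All (0 <_) γ → Filling γ → Set
IsImmaculate γ _ S =
  (∀ i j → 0 < S i j)
  × (∀ i (j k : Fin (lookup γ i)) → toℕ j ≤ toℕ k → S i j ≤ S i k)
  × (∀ (i i' : Fin (length γ)) (p : 0 < lookup γ i) (p' : 0 < lookup γ i')
       → toℕ i < toℕ i' → S i (fromℕ< p) < S i' (fromℕ< p'))

countVal : (γ : List ℕ) → Filling γ → ℕ → ℕ
countVal γ S v =
  sumFin (length γ) (λ i → sumFin (lookup γ i) (λ j → if S i j ≡ᵇ v then 1 else 0))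

at : List ℕ → ℕ → ℕ
at []       _       = 0
at (x ∷ _)  zero    = x
at (_ ∷ xs) (suc k) = at xs k

-- the content of S (weak composition: entry v is #entries equal to v) is β
HasContent : (γ : List ℕ) → Filling γ → List ℕ → Set
HasContent γ S β = ∀ v → countVal γ S (suc v) ≡ at β v

-- Δ(T)_i = γ_i + σ_i - i  (0-based indices; same difference as 1-based)
Δ : (γ : List ℕ) → Permutation′ (length γ) → List ℤ
Δ γ σ = tabulate (λ i → (+ lookup γ i) +ℤ (+ toℕ (σ ⟨$⟩ʳ i)) - (+ toℕ i))

fl : List ℤ → List ℤ
fl = filter (λ z → ¬? (z ≟ + 0))

-- An element of C_{α,β}. A THC T of shape γ is identified with perm(T) ∈ S_ℓ
-- (the bijection T ↦ perm(T)); its content is fl(Δ(T)).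
record CPair (α β : List ℕ) : Set where
  field
    γ        : List ℕ
    γ-pos    : All (0 <_) γ
    σ        : Permutation′ (length γ)
    T-content : fl (Δ γ σ) ≡ map +_ α
    S        : Filling γ
    S-imm    : IsImmaculate γ γ-pos S
    S-content : HasContent γ S β

-- permutation as a function on ℕ (identity outside 0..ℓ-1), for comparison
permℕ : (γ : List ℕ) → Permutation′ (length γ) → ℕ → ℕ
permℕ γ σ k with k <? length γ
... | yes p = toℕ (σ ⟨$⟩ʳ fromℕ< p)
... | no _  = k

-- entries of a filling indexed by ℕ (0 outside the diagram), for comparison
entryℕ : (γ : List ℕ) → Filling γ → ℕ → ℕ → ℕ
entryℕ γ S i j with i <? length γ
... | no _ = 0
... | yes p with j <? lookup γ (fromℕ< p)
...   | yes q = S (fromℕ< p) (fromℕ< q)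
...   | no _  = 0

-- two elements of C_{α,β} are the same pair (T,S): same shape, same perm(T)
-- (hence same THC), same entries of S on the diagram
SamePair : ∀ {α β} → CPair α β → CPair α β → Set
SamePair c c' =
  (CPair.γ c ≡ CPair.γ c')
  × (∀ k → permℕ (CPair.γ c) (CPair.σ c) k ≡ permℕ (CPair.γ c') (CPair.σ c') k)
  × (∀ i j → entryℕ (CPair.γ c) (CPair.S c) i j ≡ entryℕ (CPair.γ c') (CPair.S c') i j)

{-# OPTIONS --safe #-}

-- Let (T, S) ∈ C_{α,α} have shape γ and σ = perm(T), with rows and values of σ counted
-- from 0.  Every entry in row r of the immaculate tableau S exceeds r, so the
-- α₁ + ⋯ + αᵢ entries ≤ i of S lie in its first i rows: α is dominated by γ.  Since fl
-- only deletes zeros and α has no negative parts, the partial sums of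
-- Δ(T) = (γₖ + σₖ − k)ₖ are bounded by those of α.  Together these give
-- Σ_{k<i} σₖ ≤ Σ_{k<i} k for every i, which forces σ = id.  Then Δ(T) = γ, hence γ = α,
-- and equality in the dominance forces row r of S to be filled with r + 1.  Conversely
-- the identity THC with the superstandard tableau lies in C_{α,α}.

module Submission where

open import Defs
open import Data.Nat using (ℕ)
open import Data.List using (List)
open import Data.Fin.Permutation using (_⟨$⟩ʳ_)
open import Data.Product using (Σ; _×_)
open import Relation.Binary.PropositionalEquality using (_≡_)

open import Function using (id; _∘_)
open import Algebra.Properties.CommutativeSemigroup using (interchange)
open import Data.Bool using (if_then_else_)
open import Data.Nat using (zero; suc; _+_; _≤_; _<_; _<?_; _≤?_; _≡ᵇ_; z≤n; s≤s)
open import Data.Nat.Properties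
  using ( ≤-refl; ≤-reflexive; ≤-trans; ≤-antisym; <-trans; <-irrefl; ≮⇒≥; ≰⇒>
        ; m≤m+n; +-mono-≤; +-monoˡ-≤; +-cancelˡ-≤; +-cancelʳ-≤; +-cancelˡ-≡
        ; +-identityʳ; +-assoc; +-commutativeSemigroup; module ≤-Reasoning )
open import Data.Nat.Induction using (<-rec)
open import Data.Fin using (Fin; toℕ; fromℕ<; inject₁)
open import Data.Fin.Properties
  using (toℕ-fromℕ<; fromℕ<-toℕ; toℕ-injective; toℕ<n; toℕ-inject₁)
open import Data.Fin.Permutation as Permutation using (Permutation′; _⟨$⟩ˡ_)
open import Data.List using ([]; _∷_; length; lookup; map; tabulate)
open import Data.List.Properties
  using (∷-injective; map-injective; tabulate-cong; map-tabulate; tabulate-lookup; filter-all)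
open import Data.List.Relation.Unary.All as All using (All; _∷_)
open import Data.List.Relation.Unary.All.Properties using (map⁺)
open import Data.Integer as ℤ using (ℤ; +_)
import Data.Integer.Properties as ℤ
open import Algebra.Properties.AbelianGroup ℤ.+-0-abelianGroup
  using (//-rightDividesˡ; //-rightDividesʳ)
open import Data.Product using (_,_; proj₁; proj₂)
open import Relation.Nullary using (yes; no; ¬_; ¬?; contradiction)
open import Relation.Binary.PropositionalEquality
  using (refl; sym; trans; cong; cong₂; subst; subst₂; module ≡-Reasoning)

prefixSum : (ℕ → ℕ) → ℕ → ℕ
prefixSum f zero    = 0
prefixSum f (suc i) = f 0 + prefixSum (f ∘ suc) i

prefixSum-cong : ∀ {f g} i → (∀ {k} → k < i → f k ≡ g k) →
                 prefixSum f i ≡ prefixSum g i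
prefixSum-cong zero    f≡g = refl
prefixSum-cong (suc i) f≡g =
  cong₂ _+_ (f≡g (s≤s z≤n)) (prefixSum-cong i (f≡g ∘ s≤s))

prefixSum-zero : ∀ i → prefixSum (λ _ → 0) i ≡ 0
prefixSum-zero zero    = refl
prefixSum-zero (suc i) = prefixSum-zero i

prefixSum-snoc : ∀ f i → prefixSum f (suc i) ≡ prefixSum f i + f i
prefixSum-snoc f zero    = +-identityʳ (f 0)
prefixSum-snoc f (suc i) =
  trans (cong (_+_ (f 0)) (prefixSum-snoc (f ∘ suc) i)) (sym (+-assoc (f 0) _ _))

prefixSum-+ : ∀ f g i → prefixSum (λ k → f k + g k) i ≡ prefixSum f i + prefixSum g i
prefixSum-+ f g zero    = refl
prefixSum-+ f g (suc i) =
  trans (cong (_+_ (f 0 + g 0)) (prefixSum-+ (f ∘ suc) (g ∘ suc) i))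
        (interchange +-commutativeSemigroup (f 0) (g 0) _ _)

sumFin-cong : ∀ m {f g : Fin m → ℕ} → (∀ r → f r ≡ g r) → sumFin m f ≡ sumFin m g
sumFin-cong zero    f≡g = refl
sumFin-cong (suc m) f≡g = cong₂ _+_ (f≡g Fin.zero) (sumFin-cong m (f≡g ∘ Fin.suc))

sumFin-mono : ∀ m {f g : Fin m → ℕ} → (∀ r → f r ≤ g r) → sumFin m f ≤ sumFin m g
sumFin-mono zero    f≤g = z≤n
sumFin-mono (suc m) f≤g = +-mono-≤ (f≤g Fin.zero) (sumFin-mono m (f≤g ∘ Fin.suc))

sumFin-zero : ∀ m → sumFin m (λ _ → 0) ≡ 0
sumFin-zero zero    = refl
sumFin-zero (suc m) = sumFin-zero m

sumFin-one : ∀ m → sumFin m (λ _ → 1) ≡ m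
sumFin-one zero    = refl
sumFin-one (suc m) = cong suc (sumFin-one m)

sumFin-+ : ∀ m (f g : Fin m → ℕ) → sumFin m (λ r → f r + g r) ≡ sumFin m f + sumFin m g
sumFin-+ zero    f g = refl
sumFin-+ (suc m) f g =
  trans (cong (_+_ (f Fin.zero + g Fin.zero)) (sumFin-+ m (f ∘ Fin.suc) (g ∘ Fin.suc)))
        (interchange +-commutativeSemigroup (f Fin.zero) (g Fin.zero) _ _)

+-mono-≤-≡ : ∀ {a b c d} → a ≤ b → c ≤ d → a + c ≡ b + d → a ≡ b × c ≡ d
+-mono-≤-≡ {a} {b} {c} {d} a≤b c≤d a+c≡b+d =
  a≡b , +-cancelˡ-≡ a c d (trans a+c≡b+d (cong (_+ d) (sym a≡b)))
  where
  open ≤-Reasoning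
  a≡b : a ≡ b
  a≡b = ≤-antisym a≤b (+-cancelʳ-≤ c b a (begin
    b + c ≤⟨ +-mono-≤ ≤-refl c≤d ⟩
    b + d ≡⟨ a+c≡b+d ⟨
    a + c ∎))

sumFin-mono-≡ : ∀ m {f g : Fin m → ℕ} → (∀ r → f r ≤ g r) → sumFin m f ≡ sumFin m g →
                ∀ r → f r ≡ g r
sumFin-mono-≡ (suc m) f≤g Σf≡Σg r
  with +-mono-≤-≡ (f≤g Fin.zero) (sumFin-mono m (f≤g ∘ Fin.suc)) Σf≡Σg | r
... | f0≡g0 , _ | Fin.zero  = f0≡g0
... | _ , rest  | Fin.suc r′ = sumFin-mono-≡ m (f≤g ∘ Fin.suc) rest r′

prefixSum-sumFin-comm : ∀ m (G : ℕ → Fin m → ℕ) i →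
  prefixSum (λ v → sumFin m (G v)) i ≡ sumFin m (λ r → prefixSum (λ v → G v r) i)
prefixSum-sumFin-comm m G zero    = sym (sumFin-zero m)
prefixSum-sumFin-comm m G (suc i) =
  trans (cong (_+_ (sumFin m (G 0))) (prefixSum-sumFin-comm m (G ∘ suc) i))
        (sym (sumFin-+ m (G 0) _))

atℤ : List ℤ → ℕ → ℤ
atℤ []       _       = + 0
atℤ (x ∷ _)  zero    = x
atℤ (_ ∷ xs) (suc k) = atℤ xs k

prefixSumℤ : (ℕ → ℤ) → ℕ → ℤ
prefixSumℤ f zero    = + 0
prefixSumℤ f (suc i) = f 0 ℤ.+ prefixSumℤ (f ∘ suc) i

prefixSumℤ-cong : ∀ {f g} i → (∀ {k} → k < i → f k ≡ g k) →
                  prefixSumℤ f i ≡ prefixSumℤ g i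
prefixSumℤ-cong zero    f≡g = refl
prefixSumℤ-cong (suc i) f≡g =
  cong₂ ℤ._+_ (f≡g (s≤s z≤n)) (prefixSumℤ-cong i (f≡g ∘ s≤s))

prefixSumℤ-zero : ∀ i → prefixSumℤ (λ _ → + 0) i ≡ + 0
prefixSumℤ-zero zero    = refl
prefixSumℤ-zero (suc i) = trans (ℤ.+-identityˡ _) (prefixSumℤ-zero i)

prefixSumℤ-+ : ∀ f g i →
               prefixSumℤ (λ k → f k ℤ.+ g k) i ≡ prefixSumℤ f i ℤ.+ prefixSumℤ g i
prefixSumℤ-+ f g zero    = refl
prefixSumℤ-+ f g (suc i) =
  trans (cong (ℤ._+_ (f 0 ℤ.+ g 0)) (prefixSumℤ-+ (f ∘ suc) (g ∘ suc) i))
        (interchange ℤ.+-commutativeSemigroup (f 0) (g 0) _ _)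

prefixSumℤ-pos : ∀ f i → prefixSumℤ (+_ ∘ f) i ≡ + prefixSum f i
prefixSumℤ-pos f zero    = refl
prefixSumℤ-pos f (suc i) = cong (ℤ._+_ (+ f 0)) (prefixSumℤ-pos (f ∘ suc) i)

fl-prefixSum-≤ : ∀ xs ys → fl xs ≡ map +_ ys →
                 ∀ i → prefixSumℤ (atℤ xs) i ℤ.≤ + prefixSum (at ys) i
fl-prefixSum-≤ [] [] _ i =
  ℤ.≤-reflexive (trans (prefixSumℤ-zero i) (cong +_ (sym (prefixSum-zero i))))
fl-prefixSum-≤ (x ∷ xs) ys fl≡ i with x ℤ.≟ + 0
fl-prefixSum-≤ (x ∷ xs) ys fl≡ zero    | yes refl = ℤ.≤-refl
fl-prefixSum-≤ (x ∷ xs) ys fl≡ (suc i) | yes refl = begin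
  + 0 ℤ.+ prefixSumℤ (atℤ xs) i      ≡⟨ ℤ.+-identityˡ _ ⟩
  prefixSumℤ (atℤ xs) i              ≤⟨ fl-prefixSum-≤ xs ys fl≡ i ⟩
  + prefixSum (at ys) i              ≤⟨ ℤ.+≤+ (m≤m+n _ _) ⟩
  + (prefixSum (at ys) i + at ys i)  ≡⟨ cong +_ (prefixSum-snoc (at ys) i) ⟨
  + prefixSum (at ys) (suc i)        ∎
  where open ℤ.≤-Reasoning
fl-prefixSum-≤ (x ∷ xs) (y ∷ ys) fl≡ zero    | no _ = ℤ.≤-refl
fl-prefixSum-≤ (x ∷ xs) (y ∷ ys) fl≡ (suc i) | no _ with ∷-injective fl≡
... | refl , fl≡′ = ℤ.+-monoʳ-≤ (+ y) (fl-prefixSum-≤ xs ys fl≡′ i)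

atℤ-tabulate : ∀ {n} (f : Fin n → ℤ) {k} (k<n : k < n) →
               atℤ (tabulate f) k ≡ f (fromℕ< k<n)
atℤ-tabulate {suc n} f {zero}  _         = refl
atℤ-tabulate {suc n} f {suc k} (s≤s k<n) = atℤ-tabulate (f ∘ Fin.suc) k<n

at-lookup : ∀ γ {k} (k<ℓ : k < length γ) → at γ k ≡ lookup γ (fromℕ< k<ℓ)
at-lookup (x ∷ γ) {zero}  _         = refl
at-lookup (x ∷ γ) {suc k} (s≤s k<ℓ) = at-lookup γ k<ℓ

module _ (γ : List ℕ) (σ : Permutation′ (length γ)) where

  permℕ-< : ∀ {k} (k<ℓ : k < length γ) → permℕ γ σ k ≡ toℕ (σ ⟨$⟩ʳ fromℕ< k<ℓ)
  permℕ-< {k} k<ℓ with k <? length γ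
  ... | yes _   = refl
  ... | no k≮ℓ = contradiction k<ℓ k≮ℓ

  permℕ-identity : (∀ r → σ ⟨$⟩ʳ r ≡ r) → ∀ k → permℕ γ σ k ≡ k
  permℕ-identity σ≗id k with k <? length γ
  ... | yes k<ℓ = trans (cong toℕ (σ≗id _)) (toℕ-fromℕ< k<ℓ)
  ... | no _    = refl

  permℕ-toℕ : ∀ r → permℕ γ σ (toℕ r) ≡ toℕ (σ ⟨$⟩ʳ r)
  permℕ-toℕ r =
    trans (permℕ-< (toℕ<n r)) (cong (toℕ ∘ (σ ⟨$⟩ʳ_)) (fromℕ<-toℕ r _))

  permℕ-injective : ∀ {k k′} (k<ℓ : k < length γ) (k′<ℓ : k′ < length γ) →
                    permℕ γ σ k ≡ permℕ γ σ k′ → k ≡ k′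
  permℕ-injective {k} {k′} k<ℓ k′<ℓ σk≡σk′ = begin
    k                  ≡⟨ toℕ-fromℕ< k<ℓ ⟨
    toℕ (fromℕ< k<ℓ)   ≡⟨ cong toℕ (σ-injective (toℕ-injective σr≡σr′)) ⟩
    toℕ (fromℕ< k′<ℓ)  ≡⟨ toℕ-fromℕ< k′<ℓ ⟩
    k′                 ∎
    where
    open ≡-Reasoning
    σr≡σr′ : toℕ (σ ⟨$⟩ʳ fromℕ< k<ℓ) ≡ toℕ (σ ⟨$⟩ʳ fromℕ< k′<ℓ)
    σr≡σr′ = trans (sym (permℕ-< k<ℓ)) (trans σk≡σk′ (permℕ-< k′<ℓ))
    σ-injective : ∀ {r r′} → σ ⟨$⟩ʳ r ≡ σ ⟨$⟩ʳ r′ → r ≡ r′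
    σ-injective σr≡σr′ = trans (sym (Permutation.inverseˡ σ))
                               (trans (cong (σ ⟨$⟩ˡ_) σr≡σr′) (Permutation.inverseˡ σ))

  -- Induction on k: once σ fixes every k′ < k, the prefix sums up to suc k give σ k ≤ k,
  -- and σ k < k would give σ (σ k) = σ k, contradicting injectivity.
  prefixSum-≤⇒identity :
    (∀ i → i ≤ length γ → prefixSum (permℕ γ σ) i ≤ prefixSum id i) →
    ∀ r → σ ⟨$⟩ʳ r ≡ r
  prefixSum-≤⇒identity dominated r =
    toℕ-injective (trans (sym (permℕ-toℕ r)) (fixes (toℕ r) (toℕ<n r)))
    where
    s = permℕ γ σ

    fixes-next : ∀ k → k < length γ → (∀ {k′} → k′ < k → s k′ ≡ k′) → s k ≡ k
    fixes-next k k<ℓ fixed = ≤-antisym sk≤k (≮⇒≥ sk≮k)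
      where
      open ≤-Reasoning
      sk≤k : s k ≤ k
      sk≤k = +-cancelˡ-≤ (prefixSum id k) (s k) k (begin
        prefixSum id k + s k  ≡⟨ cong (_+ s k) (prefixSum-cong k fixed) ⟨
        prefixSum s k + s k   ≡⟨ prefixSum-snoc s k ⟨
        prefixSum s (suc k)   ≤⟨ dominated (suc k) k<ℓ ⟩
        prefixSum id (suc k)  ≡⟨ prefixSum-snoc id k ⟩
        prefixSum id k + k    ∎)
      sk≮k : ¬ s k < k
      sk≮k sk<k = <-irrefl (permℕ-injective (<-trans sk<k k<ℓ) k<ℓ (fixed sk<k)) sk<k

    fixes : ∀ k → k < length γ → s k ≡ k
    fixes = <-rec (λ k → k < length γ → s k ≡ k) λ k below k<ℓ →
      fixes-next k k<ℓ (λ k′<k → below k′<k (<-trans k′<k k<ℓ))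

  Δ-atℤ : ∀ {k} → k < length γ → atℤ (Δ γ σ) k ℤ.+ + k ≡ + (at γ k + permℕ γ σ k)
  Δ-atℤ {k} k<ℓ = begin
    atℤ (Δ γ σ) k ℤ.+ + k            ≡⟨ cong (λ z → z ℤ.+ + k) (atℤ-tabulate _ k<ℓ) ⟩
    (+ (a + b) ℤ.- + toℕ r) ℤ.+ + k  ≡⟨ cong (λ m → (+ (a + b) ℤ.- + m) ℤ.+ + k) (toℕ-fromℕ< k<ℓ) ⟩
    (+ (a + b) ℤ.- + k) ℤ.+ + k      ≡⟨ //-rightDividesˡ (+ k) _ ⟩
    + (a + b)                        ≡⟨ cong₂ (λ a b → + (a + b)) (at-lookup γ k<ℓ) (permℕ-< k<ℓ) ⟨
    + (at γ k + permℕ γ σ k)         ∎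
    where
    open ≡-Reasoning
    r = fromℕ< k<ℓ
    a = lookup γ r
    b = toℕ (σ ⟨$⟩ʳ r)

  Δ-prefixSum-≤ : ∀ {β} → fl (Δ γ σ) ≡ map +_ β → ∀ {i} → i ≤ length γ →
    prefixSum (at γ) i + prefixSum (permℕ γ σ) i ≤ prefixSum (at β) i + prefixSum id i
  Δ-prefixSum-≤ {β} T-content {i} i≤ℓ = ℤ.drop‿+≤+ (begin
    + (prefixSum (at γ) i + prefixSum s i)  ≡⟨ cong +_ (prefixSum-+ (at γ) s i) ⟨
    + prefixSum (λ k → at γ k + s k) i      ≡⟨ prefixSumℤ-pos _ i ⟨
    prefixSumℤ (λ k → + (at γ k + s k)) i   ≡⟨ prefixSumℤ-cong i (λ k<i → Δ-atℤ (≤-trans k<i i≤ℓ)) ⟨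
    prefixSumℤ (λ k → Δₖ k ℤ.+ + k) i       ≡⟨ prefixSumℤ-+ Δₖ (+_ ∘ id) i ⟩
    prefixSumℤ Δₖ i ℤ.+ prefixSumℤ (+_ ∘ id) i
                                            ≡⟨ cong (ℤ._+_ (prefixSumℤ Δₖ i)) (prefixSumℤ-pos id i) ⟩
    prefixSumℤ Δₖ i ℤ.+ + prefixSum id i
                                            ≤⟨ ℤ.+-monoˡ-≤ _ (fl-prefixSum-≤ (Δ γ σ) β T-content i) ⟩
    + (prefixSum (at β) i + prefixSum id i) ∎)
    where
    open ℤ.≤-Reasoning
    s = permℕ γ σ
    Δₖ = atℤ (Δ γ σ)

  Δ-identity : (∀ r → σ ⟨$⟩ʳ r ≡ r) → Δ γ σ ≡ map +_ γ
  Δ-identity σ≗id = begin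
    Δ γ σ                         ≡⟨ tabulate-cong Δᵣ≡γᵣ ⟩
    tabulate (+_ ∘ lookup γ)      ≡⟨ map-tabulate (lookup γ) (+_) ⟨
    map +_ (tabulate (lookup γ))  ≡⟨ cong (map (+_)) (tabulate-lookup γ) ⟩
    map +_ γ                      ∎
    where
    open ≡-Reasoning
    Δᵣ≡γᵣ : ∀ r → + (lookup γ r + toℕ (σ ⟨$⟩ʳ r)) ℤ.- + toℕ r ≡ + lookup γ r
    Δᵣ≡γᵣ r = trans (cong (λ q → + (lookup γ r + toℕ q) ℤ.- + toℕ r) (σ≗id r))
                    (//-rightDividesʳ (+ toℕ r) (+ lookup γ r))

positive⇒≢0 : ∀ {x} → 0 < x → ¬ (+ x ≡ + 0)
positive⇒≢0 (s≤s _) ()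

fl-positive : ∀ {γ} → All (0 <_) γ → fl (map +_ γ) ≡ map +_ γ
fl-positive γ-pos = filter-all (λ z → ¬? (z ℤ.≟ + 0)) (map⁺ (All.map positive⇒≢0 γ-pos))

increasing⇒index< : ∀ {ℓ} (f : Fin ℓ → ℕ) → (∀ r → 0 < f r) →
                   (∀ r r′ → toℕ r < toℕ r′ → f r < f r′) → ∀ r → toℕ r < f r
increasing⇒index< {suc ℓ} f positive increasing Fin.zero    = positive Fin.zero
increasing⇒index< {suc ℓ} f positive increasing (Fin.suc r) =
  ≤-trans (s≤s (increasing⇒index< (f ∘ inject₁) (positive ∘ inject₁) increasing′ r))
          (increasing (inject₁ r) (Fin.suc r) (s≤s (≤-reflexive (toℕ-inject₁ r))))
  where
  increasing′ : ∀ r r′ → toℕ r < toℕ r′ → f (inject₁ r) < f (inject₁ r′)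
  increasing′ r r′ r<r′ =
    increasing _ _ (subst₂ _<_ (sym (toℕ-inject₁ r)) (sym (toℕ-inject₁ r′)) r<r′)

atMost : ℕ → ℕ → ℕ
atMost i x = prefixSum (λ v → if x ≡ᵇ suc v then 1 else 0) i

atMost-≤1 : ∀ i x → atMost i x ≤ 1
atMost-≤1 zero    x             = z≤n
atMost-≤1 (suc i) zero          = ≤-trans (≤-reflexive (prefixSum-zero i)) z≤n
atMost-≤1 (suc i) (suc zero)    = s≤s (≤-reflexive (prefixSum-zero i))
atMost-≤1 (suc i) (suc (suc x)) = atMost-≤1 i (suc x)

atMost-> : ∀ i x → i < x → atMost i x ≡ 0
atMost-> zero    x             _         = refl
atMost-> (suc i) (suc (suc x)) (s≤s i<x) = atMost-> i (suc x) i<x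

atMost≡1⇒≤ : ∀ i x → atMost i x ≡ 1 → x ≤ i
atMost≡1⇒≤ i x atMost≡1 with x ≤? i
... | yes x≤i = x≤i
... | no x≰i  with () ← trans (sym atMost≡1) (atMost-> i x (≰⇒> x≰i))

cutoff : ℕ → ℕ → ℕ → ℕ
cutoff zero    _       _ = 0
cutoff (suc i) zero    x = x
cutoff (suc i) (suc r) x = cutoff i r x

cutoff-< : ∀ i r x → r < i → cutoff i r x ≡ x
cutoff-< (suc i) zero    x _         = refl
cutoff-< (suc i) (suc r) x (s≤s r<i) = cutoff-< i r x r<i

cutoff-≥ : ∀ i r x → i ≤ r → cutoff i r x ≡ 0
cutoff-≥ zero    r       x _         = refl
cutoff-≥ (suc i) (suc r) x (s≤s i≤r) = cutoff-≥ i r x i≤r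

sumFin-cutoff : ∀ γ i →
                sumFin (length γ) (λ r → cutoff i (toℕ r) (lookup γ r)) ≡ prefixSum (at γ) i
sumFin-cutoff []      i       = sym (prefixSum-zero i)
sumFin-cutoff (x ∷ γ) zero    = sumFin-zero (length γ)
sumFin-cutoff (x ∷ γ) (suc i) = cong (_+_ x) (sumFin-cutoff γ i)

All-lookup : ∀ {P : ℕ → Set} {γ} → All P γ → (r : Fin (length γ)) → P (lookup γ r)
All-lookup (p ∷ _)  Fin.zero    = p
All-lookup (_ ∷ ps) (Fin.suc r) = All-lookup ps r

module ImmaculateTableau {γ : List ℕ} {γ-pos : All (0 <_) γ} {S : Filling γ}
                         (S-imm : IsImmaculate γ γ-pos S) where

  private
    ℓ = length γ
    positive    = proj₁ S-imm
    rowMonotone = proj₁ (proj₂ S-imm)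
    column<     = proj₂ (proj₂ S-imm)

  index<entry : ∀ r j → toℕ r < S r j
  index<entry r j =
    ≤-trans (increasing⇒index< firstColumn (λ r → positive r _) increasing r)
            (rowMonotone r (first r) j (subst (_≤ toℕ j) (sym (toℕ-fromℕ< _)) z≤n))
    where
    first : ∀ r → Fin (lookup γ r)
    first r = fromℕ< (All-lookup γ-pos r)
    firstColumn : Fin ℓ → ℕ
    firstColumn r = S r (first r)
    increasing : ∀ r r′ → toℕ r < toℕ r′ → firstColumn r < firstColumn r′
    increasing r r′ = column< r r′ (All-lookup γ-pos r) (All-lookup γ-pos r′)

  rowCount : ℕ → Fin ℓ → ℕ
  rowCount i r = sumFin (lookup γ r) (λ j → atMost i (S r j))

  rowCount-≤ : ∀ i r → rowCount i r ≤ cutoff i (toℕ r) (lookup γ r)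
  rowCount-≤ i r with toℕ r <? i
  ... | yes r<i rewrite cutoff-< i (toℕ r) (lookup γ r) r<i =
    ≤-trans (sumFin-mono _ (λ j → atMost-≤1 i (S r j))) (≤-reflexive (sumFin-one _))
  ... | no r≮i rewrite cutoff-≥ i (toℕ r) (lookup γ r) (≮⇒≥ r≮i) =
    ≤-reflexive (trans (sumFin-cong _ noneAtMost) (sumFin-zero (lookup γ r)))
    where
    noneAtMost : ∀ j → atMost i (S r j) ≡ 0
    noneAtMost j = atMost-> i (S r j) (≤-trans (s≤s (≮⇒≥ r≮i)) (index<entry r j))

  content-prefixSum : ∀ {β} → HasContent γ S β →
                      ∀ i → prefixSum (at β) i ≡ sumFin ℓ (rowCount i)
  content-prefixSum {β} content i = begin
    prefixSum (at β) i
      ≡⟨ prefixSum-cong i (λ {v} _ → sym (content v)) ⟩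
    prefixSum (λ v → countVal γ S (suc v)) i
      ≡⟨ prefixSum-sumFin-comm ℓ _ i ⟩
    sumFin ℓ (λ r → prefixSum (λ v → sumFin (lookup γ r) (hit r v)) i)
      ≡⟨ sumFin-cong ℓ (λ r → prefixSum-sumFin-comm (lookup γ r) (hit r) i) ⟩
    sumFin ℓ (rowCount i)
      ∎
    where
    open ≡-Reasoning
    hit : ∀ r → ℕ → Fin (lookup γ r) → ℕ
    hit r v j = if S r j ≡ᵇ suc v then 1 else 0

  content-dominated : ∀ {β} → HasContent γ S β →
                      ∀ i → prefixSum (at β) i ≤ prefixSum (at γ) i
  content-dominated {β} content i = begin
    prefixSum (at β) i                                  ≡⟨ content-prefixSum {β} content i ⟩
    sumFin ℓ (rowCount i)                               ≤⟨ sumFin-mono ℓ (rowCount-≤ i) ⟩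
    sumFin ℓ (λ r → cutoff i (toℕ r) (lookup γ r))      ≡⟨ sumFin-cutoff γ i ⟩
    prefixSum (at γ) i                                  ∎
    where open ≤-Reasoning

  -- With content γ the dominance is an equality for every i, so each row r < i
  -- contributes all its lookup γ r cells to the count of entries ≤ i; take i = suc r.
  content-shape⇒superstandard : HasContent γ S γ → ∀ r j → S r j ≡ suc (toℕ r)
  content-shape⇒superstandard content r j =
    ≤-antisym (atMost≡1⇒≤ i (S r j) (cellsAtMost j)) (index<entry r j)
    where
    i = suc (toℕ r)
    rowCounts≡cutoffs : sumFin ℓ (rowCount i) ≡ sumFin ℓ (λ r → cutoff i (toℕ r) (lookup γ r))
    rowCounts≡cutoffs = trans (sym (content-prefixSum {γ} content i)) (sym (sumFin-cutoff γ i))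
    rowFull : rowCount i r ≡ sumFin (lookup γ r) (λ _ → 1)
    rowFull = trans (sumFin-mono-≡ ℓ (rowCount-≤ i) rowCounts≡cutoffs r)
              (trans (cutoff-< i (toℕ r) (lookup γ r) ≤-refl) (sym (sumFin-one (lookup γ r))))
    cellsAtMost : ∀ j → atMost i (S r j) ≡ 1
    cellsAtMost = sumFin-mono-≡ (lookup γ r) (λ j → atMost-≤1 i (S r j)) rowFull

superstandard : (γ : List ℕ) → Filling γ
superstandard γ r _ = suc (toℕ r)

superstandard-content : ∀ γ → HasContent γ (superstandard γ) γ
superstandard-content []      v       = refl
superstandard-content (x ∷ γ) zero    = begin
  sumFin x (λ _ → 1) + sumFin (length γ) (λ r → sumFin (lookup γ r) (λ _ → 0))
    ≡⟨ cong₂ _+_ (sumFin-one x) (sumFin-cong (length γ) (sumFin-zero ∘ lookup γ)) ⟩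
  x + sumFin (length γ) (λ _ → 0)  ≡⟨ cong (_+_ x) (sumFin-zero (length γ)) ⟩
  x + 0                            ≡⟨ +-identityʳ x ⟩
  x                                ∎
  where open ≡-Reasoning
superstandard-content (x ∷ γ) (suc v) = cong₂ _+_ (sumFin-zero x) (superstandard-content γ v)

superstandardPair : ∀ {α} → All (0 <_) α → CPair α α
superstandardPair {α} α-pos = record
  { γ         = α
  ; γ-pos     = α-pos
  ; σ         = Permutation.id
  ; T-content = trans (cong fl (Δ-identity α Permutation.id (λ _ → refl))) (fl-positive α-pos)
  ; S         = superstandard α
  ; S-imm     = (λ _ _ → s≤s z≤n) , (λ _ _ _ _ → ≤-refl) , (λ _ _ _ _ r<r′ → s≤s r<r′)
  ; S-content = superstandard-content α
  }

module Diagonal {β : List ℕ} (c : CPair β β) where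
  open CPair c
  open ImmaculateTableau {γ} {γ-pos} {S} S-imm

  σ-identity : ∀ r → σ ⟨$⟩ʳ r ≡ r
  σ-identity = prefixSum-≤⇒identity γ σ λ i i≤ℓ → +-cancelˡ-≤ (prefixSum (at γ) i) _ _ (begin
    prefixSum (at γ) i + prefixSum (permℕ γ σ) i  ≤⟨ Δ-prefixSum-≤ γ σ T-content i≤ℓ ⟩
    prefixSum (at β) i + prefixSum id i           ≤⟨ +-monoˡ-≤ _ (content-dominated {β} S-content i) ⟩
    prefixSum (at γ) i + prefixSum id i           ∎)
    where open ≤-Reasoning

  γ≡β : γ ≡ β
  γ≡β = map-injective ℤ.+-injective (begin
    map +_ γ       ≡⟨ fl-positive γ-pos ⟨
    fl (map +_ γ)  ≡⟨ cong fl (Δ-identity γ σ σ-identity) ⟨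
    fl (Δ γ σ)     ≡⟨ T-content ⟩
    map +_ β       ∎)
    where open ≡-Reasoning

  S-superstandard : ∀ r j → S r j ≡ suc (toℕ r)
  S-superstandard = content-shape⇒superstandard (subst (HasContent γ S) (sym γ≡β) S-content)

entryℕ-cong : ∀ γ {S S′ : Filling γ} → (∀ r j → S r j ≡ S′ r j) →
              ∀ i j → entryℕ γ S i j ≡ entryℕ γ S′ i j
entryℕ-cong γ S≡S′ i j with i <? length γ
... | no _  = refl
... | yes i<ℓ with j <? lookup γ (fromℕ< i<ℓ)
...   | yes _ = S≡S′ _ _
...   | no _  = refl

lemma4p1 : (n : ℕ) (α : List ℕ) → IsComposition n α →
    Σ (CPair α α) (λ c →
      (∀ i → CPair.σ c ⟨$⟩ʳ i ≡ i)
      × (∀ (c' : CPair α α) → SamePair c c'))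
lemma4p1 n α (α-pos , _) = superstandardPair α-pos , (λ _ → refl) , unique
  where
  unique : ∀ c → SamePair (superstandardPair α-pos) c
  unique c =
      sym γ≡β
    , (λ k → trans (permℕ-identity α Permutation.id (λ _ → refl) k)
                   (sym (permℕ-identity γ σ σ-identity k)))
    , (λ i j → trans (cong (λ γ′ → entryℕ γ′ (superstandard γ′) i j) (sym γ≡β))
                     (entryℕ-cong γ (λ r j → sym (S-superstandard r j)) i j))
    where
    open CPair c
    open Diagonal c
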